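{- Let $G$ be a finite transitive permutation group on a set $\Omega$, let $v\in\Omega$, let $N$ be a normal subgroup of $G$, and let $C$ be a semiregular subgroup of $G$ with $k$ orbits on $\Omega$. If $|N|$ is coprime to $|G_v|$, then the action induced by $C$ on the set of $N$-orbits (i.e. the action of $CN/N$ on the set of $N$-orbits) is semiregular with $k'$ orbits, where $k'$ divides $k$.
   Context: A permutation group is semiregular if its only element fixing a point is the identity. $G_v$ denotes the stabiliser of $v$ in $G$. -}

module Defs where

open import Data.Nat using (ℕ)
open import Data.Fin using (Fin)
open import Data.Vec using (Vec; lookup; tabulate; allFin)
open import Data.List using (List; length; filter)
open import Data.List.Membership.Propositional using (_∈_)
open import Data.List.Relation.Unary.Unique.Propositional using (Unique)
open import Data.Product using (Σ; ∃; _×_)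
open import Data.Fin.Properties using (_≟_)
open import Relation.Binary.PropositionalEquality using (_≡_)

-- A map Ω → Ω on Ω = Fin n, given by its table of values (x ↦ lookup t x).
Map : ℕ → Set
Map n = Vec (Fin n) n

app : ∀ {n} → Map n → Fin n → Fin n
app t x = lookup t x

-- t is a permutation of Fin n (injective, hence bijective on a finite set)
IsPerm : ∀ {n} → Map n → Set
IsPerm t = ∀ x y → app t x ≡ app t y → x ≡ y

idPerm : ∀ {n} → Map n
idPerm {n} = allFin n

_∘ₚ_ : ∀ {n} → Map n → Map n → Map n
g ∘ₚ h = tabulate (λ x → app g (app h x))

-- A finite permutation group on Fin n, given as the duplicate-free list of
-- its elements: all elements are permutations, the identity belongs to it,
-- and it is closed under composition (for a finite set of permutations this
-- is equivalent to being a subgroup of Sym(n)).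
record IsPermGroup {n} (G : List (Map n)) : Set where
  field
    perms  : ∀ {g} → g ∈ G → IsPerm g
    unique : Unique G
    hasId  : idPerm ∈ G
    closed : ∀ {g h} → g ∈ G → h ∈ G → (g ∘ₚ h) ∈ G

∣_∣ᴳ : ∀ {n} → List (Map n) → ℕ
∣ G ∣ᴳ = length G

_⊆ᴳ_ : ∀ {n} → List (Map n) → List (Map n) → Set
H ⊆ᴳ G = ∀ {h} → h ∈ H → h ∈ G

IsSubgroup : ∀ {n} → List (Map n) → List (Map n) → Set
IsSubgroup H G = IsPermGroup H × (H ⊆ᴳ G)

-- N is normal in G : gN ⊆ Ng for all g ∈ G (i.e. gNg⁻¹ ⊆ N)
IsNormal : ∀ {n} → List (Map n) → List (Map n) → Set
IsNormal N G = IsSubgroup N G ×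
  (∀ {g h} → g ∈ G → h ∈ N → ∃ λ h' → h' ∈ N × (g ∘ₚ h) ≡ (h' ∘ₚ g))

IsTransitive : ∀ {n} → List (Map n) → Set
IsTransitive {n} G = ∀ (x y : Fin n) → ∃ λ g → g ∈ G × app g x ≡ y

Stab : ∀ {n} → List (Map n) → Fin n → List (Map n)
Stab G v = filter (λ g → app g v ≟ v) G

IsSemiregular : ∀ {n} → List (Map n) → Set
IsSemiregular {n} C = ∀ {c} → c ∈ C → ∀ (x : Fin n) → app c x ≡ x → c ≡ idPerm

SameOrbit : ∀ {n} → List (Map n) → Fin n → Fin n → Set
SameOrbit H x y = ∃ λ h → h ∈ H × app h x ≡ y

HasClasses : ∀ {n} → (Fin n → Fin n → Set) → ℕ → Set
HasClasses {n} R k = Σ (Vec (Fin n) k) λ reps →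
  (∀ i j → R (lookup reps i) (lookup reps j) → i ≡ j) ×
  (∀ (x : Fin n) → ∃ λ i → R (lookup reps i) x)

HasOrbits : ∀ {n} → List (Map n) → ℕ → Set
HasOrbits H k = HasClasses (SameOrbit H) k

-- Induced action of C on the set of N-orbits (N-orbit of x written [x]):
-- c·[x] = [c x].  The N-orbits [x],[y] are in the same C-orbit iff
-- c x ~N y for some c ∈ C.
SameInducedOrbit : ∀ {n} → List (Map n) → List (Map n) → Fin n → Fin n → Set
SameInducedOrbit C N x y = ∃ λ c → c ∈ C × SameOrbit N (app c x) y

InducedHasOrbits : ∀ {n} → List (Map n) → List (Map n) → ℕ → Set
InducedHasOrbits C N k' = HasClasses (SameInducedOrbit C N) k'

-- CN/N acts semiregularly on the N-orbits: if cN fixes an N-orbit [x]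
-- (i.e. c x ~N x) then cN is the identity of CN/N, i.e. c ∈ N.
InducedSemiregular : ∀ {n} → List (Map n) → List (Map n) → Set
InducedSemiregular {n} C N =
  ∀ {c} → c ∈ C → ∀ (x : Fin n) → SameOrbit N (app c x) x → c ∈ N

module Submission where

open import Defs
open import Data.Nat using (ℕ)
open import Data.Nat.Divisibility using (_∣_)
open import Data.Nat.Coprimality using (Coprime)
open import Data.Fin using (Fin)
open import Data.List using (List)
open import Data.Product using (∃; _×_)

-- Every element fixing a point is conjugate into G_v, so it is killed
-- by |G_v|; an element of G fixing a point and killed by |N| is therefore
-- trivial.  This makes N semiregular.  If c ∈ C fixes the N-orbit of x, say
-- h c x = x with h ∈ N, then ⟨c⟩ acts freely on the N-orbit Nx, which has |N|
-- points, so ord(c) divides |N|; as (hc)^ord(c) ∈ N fixes x, it is trivial,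
-- whence hc fixes x and is killed by |N|, so hc = 1 and c ∈ N.  Consequently
-- the subgroup NC acts semiregularly on Ω, and its orbits are the orbits of
-- the induced action.  Counting points by orbits of free actions,
-- |Ω| = k·|C| = k'·|NC|, and |C| divides |NC| by Lagrange, so k' divides k.

open import Data.Nat using (zero; suc; _+_; _*_; _∸_; _<_; _%_; _/_; s≤s; NonZero)
open import Data.Nat.Properties
open import Data.Nat.DivMod using (m≡m%n+[m/n]*n; m%n<n)
open import Data.Nat.Divisibility using (divides; m%n≡0⇒n∣m)
import Data.Fin as F
open import Data.Fin using (toℕ)
import Data.Fin.Properties as FinP
open import Data.Vec using (lookup; tabulate)
open import Data.Vec.Properties using (lookup∘tabulate; tabulate∘lookup; tabulate-cong; lookup-allFin; ≡-dec)
import Data.List as L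
open import Data.List using ([]; _∷_; _++_; length; map; applyUpTo; allFin; deduplicate; cartesianProductWith)
open import Data.List.Properties using (length-++; length-map; length-applyUpTo)
open import Data.List.Membership.Propositional using (_∈_; _∉_)
open import Data.List.Membership.Propositional.Properties
  using (∈-++⁺ˡ; ∈-++⁺ʳ; ∈-++⁻; ∈-map⁺; ∈-map⁻; ∈-applyUpTo⁺; ∈-applyUpTo⁻; ∈-filter⁺; ∈-filter⁻;
         ∈-deduplicate⁺; ∈-deduplicate⁻; ∈-cartesianProductWith⁺; ∈-cartesianProductWith⁻; ∈-allFin)
open import Data.List.Membership.Propositional.Properties.WithK using (unique∧set⇒bag)
open import Data.List.Relation.Binary.BagAndSetEquality using (∼bag⇒↭)
open import Data.List.Relation.Binary.Permutation.Propositional.Properties using (↭-length)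
open import Data.List.Relation.Unary.Any as Any using (here; there)
open import Data.List.Relation.Unary.Any.Properties using (lookup-index)
import Data.List.Relation.Unary.All as All
open import Data.List.Relation.Unary.AllPairs using ([]; _∷_)
open import Data.List.Relation.Unary.Unique.Propositional using (Unique)
import Data.List.Relation.Unary.Unique.Propositional.Properties as Unique
open import Data.List.Relation.Unary.Unique.DecPropositional.Properties using (deduplicate-!)
open import Data.Product using (∃₂; _,_; proj₁; proj₂)
open import Data.Sum using (_⊎_; inj₁; inj₂; [_,_]′)
open import Data.Empty using (⊥)
open import Function using (id)
open import Function.Bundles using (mk⇔)
open import Relation.Nullary using (Dec; yes; no; ¬_; contradiction)
open import Relation.Binary using (DecidableEquality)
open import Relation.Binary.PropositionalEquality
  using (_≡_; _≢_; refl; sym; trans; cong; cong₂; subst; subst₂; module ≡-Reasoning)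
open ≡-Reasoning

module _ (P : ℕ → Set) (P? : ∀ j → Dec (P j)) where

  private
    search : ∀ b → (∀ j → j < b → ¬ P j) ⊎ (∃ λ m → P m × (∀ j → j < m → ¬ P j))
    search zero = inj₁ (λ _ ())
    search (suc b) with search b
    ... | inj₂ found = inj₂ found
    ... | inj₁ none with P? b
    ...   | yes pb = inj₂ (b , pb , none)
    ...   | no ¬pb = inj₁ λ j j<1+b → [ none j , (λ { refl → ¬pb }) ]′ (m<1+n⇒m<n∨m≡n j<1+b)

  least : ∀ d → P d → ∃ λ m → P m × (∀ j → j < m → ¬ P j)
  least d pd with search (suc d)
  ... | inj₂ found = found
  ... | inj₁ none  = contradiction pd (none d (n<1+n d))

map-unique : ∀ {A B : Set} (f : A → B) {xs : List A} →
             (∀ {a b} → a ∈ xs → b ∈ xs → f a ≡ f b → a ≡ b) →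
             Unique xs → Unique (map f xs)
map-unique f {[]} inj [] = []
map-unique f {x ∷ xs} inj (x∉xs ∷ xs!) =
  All.tabulate (λ y∈ fx≡y → let (b , b∈ , y≡fb) = ∈-map⁻ f y∈ in
                  All.lookup x∉xs b∈ (inj (here refl) (there b∈) (trans fx≡y y≡fb)))
  ∷ map-unique f (λ a∈ b∈ → inj (there a∈) (there b∈)) xs!

∈⇒length-nonZero : ∀ {A : Set} {x : A} {xs} → x ∈ xs → NonZero (length xs)
∈⇒length-nonZero {xs = _ ∷ _} _ = _

module Partition {A : Set} (_≟_ : DecidableEquality A) where

  open import Data.List.Membership.DecPropositional _≟_ using (_∈?_)

  same-members⇒same-length : ∀ {xs ys : List A} → Unique xs → Unique ys →
    (∀ {z} → z ∈ xs → z ∈ ys) → (∀ {z} → z ∈ ys → z ∈ xs) → length xs ≡ length ys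
  same-members⇒same-length xs! ys! xs⊆ys ys⊆xs =
    ↭-length (∼bag⇒↭ (unique∧set⇒bag xs! ys! (mk⇔ xs⊆ys ys⊆xs)))

  classes : ∀ k → (Fin k → A) → (A → List A) → List A
  classes zero    r cls = []
  classes (suc k) r cls = cls (r F.zero) ++ classes k (λ i → r (F.suc i)) cls

  ∈-classes⁻ : ∀ k r cls {z} → z ∈ classes k r cls → ∃ λ i → z ∈ cls (r i)
  ∈-classes⁻ (suc k) r cls z∈ with ∈-++⁻ (cls (r F.zero)) z∈
  ... | inj₁ z∈first = F.zero , z∈first
  ... | inj₂ z∈rest  = let (i , z∈ri) = ∈-classes⁻ k (λ i → r (F.suc i)) cls z∈rest in F.suc i , z∈ri

  ∈-classes⁺ : ∀ k r cls i {z} → z ∈ cls (r i) → z ∈ classes k r cls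
  ∈-classes⁺ (suc k) r cls F.zero    z∈ = ∈-++⁺ˡ z∈
  ∈-classes⁺ (suc k) r cls (F.suc i) z∈ = ∈-++⁺ʳ (cls (r F.zero)) (∈-classes⁺ k (λ i → r (F.suc i)) cls i z∈)

  length-classes : ∀ k r cls s → (∀ i → length (cls (r i)) ≡ s) → length (classes k r cls) ≡ k * s
  length-classes zero    r cls s |cls| = refl
  length-classes (suc k) r cls s |cls| = begin
    length (cls (r F.zero) ++ classes k r' cls)       ≡⟨ length-++ (cls (r F.zero)) ⟩
    length (cls (r F.zero)) + length (classes k r' cls) ≡⟨ cong₂ _+_ (|cls| F.zero) (length-classes k r' cls s (λ i → |cls| (F.suc i))) ⟩
    s + k * s                                          ∎
    where r' = λ i → r (F.suc i)

  classes-unique : ∀ k r cls → (∀ i → Unique (cls (r i))) →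
                   (∀ i j {z} → z ∈ cls (r i) → z ∈ cls (r j) → i ≡ j) →
                   Unique (classes k r cls)
  classes-unique zero    r cls cls! disjoint = []
  classes-unique (suc k) r cls cls! disjoint =
    Unique.++⁺ (cls! F.zero)
      (classes-unique k (λ i → r (F.suc i)) cls (λ i → cls! (F.suc i))
         (λ i j p q → FinP.suc-injective (disjoint (F.suc i) (F.suc j) p q)))
      (λ (z∈first , z∈rest) → 0≢suc (∈-classes⁻ k (λ i → r (F.suc i)) cls z∈rest) z∈first)
    where
      0≢suc : ∀ {z} → (∃ λ i → z ∈ cls (r (F.suc i))) → z ∈ cls (r F.zero) → ⊥
      0≢suc (i , q) p with disjoint F.zero (F.suc i) p q
      ... | ()

  record Representatives (U : List A) (cls : A → List A) : Set where
    field
      size     : ℕ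
      rep      : Fin size → A
      rep∈     : ∀ i → rep i ∈ U
      disjoint : ∀ i j {z} → z ∈ cls (rep i) → z ∈ cls (rep j) → i ≡ j
      covers   : ∀ {z} → z ∈ U → ∃ λ i → z ∈ cls (rep i)

  open Representatives

  partition-length : ∀ {U cls s} (R : Representatives U cls) → Unique U →
    (∀ i → Unique (cls (rep R i))) → (∀ i → length (cls (rep R i)) ≡ s) →
    (∀ i {z} → z ∈ cls (rep R i) → z ∈ U) → length U ≡ size R * s
  partition-length {U} {cls} {s} R U! cls! |cls| cls⊆U = begin
    length U                            ≡⟨ same-members⇒same-length U! (classes-unique k r cls cls! (disjoint R)) U⊆ ⊆U ⟩
    length (classes k r cls)            ≡⟨ length-classes k r cls s |cls| ⟩
    k * s                               ∎
    where
      k = size R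
      r = rep R
      U⊆ : ∀ {z} → z ∈ U → z ∈ classes k r cls
      U⊆ z∈ = let (i , p) = covers R z∈ in ∈-classes⁺ k r cls i p
      ⊆U : ∀ {z} → z ∈ classes k r cls → z ∈ U
      ⊆U z∈ = let (i , q) = ∈-classes⁻ k r cls z∈ in cls⊆U i q

  module _ {U : List A} {cls : A → List A}
           (self : ∀ {x} → x ∈ U → x ∈ cls x)
           (merge : ∀ {x y z w} → x ∈ U → y ∈ U → z ∈ cls x → z ∈ cls y → w ∈ cls x → w ∈ cls y) where

    absorb : ∀ {y V} (R : Representatives V cls) (i : Fin (size R)) → y ∈ cls (rep R i) →
             Representatives (y ∷ V) cls
    absorb R i y∈ = record
      { size = size R ; rep = rep R ; rep∈ = λ j → there (rep∈ R j) ; disjoint = disjoint R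
      ; covers = λ { (here refl) → i , y∈ ; (there z∈) → covers R z∈ } }

    adjoin : ∀ {y V} → y ∈ U → (∀ {x} → x ∈ V → x ∈ U) → (R : Representatives V cls) →
             (∀ i → y ∉ cls (rep R i)) → Representatives (y ∷ V) cls
    adjoin {y} {V} y∈U V⊆U R new = record
      { size = suc (size R) ; rep = rep' ; rep∈ = rep'∈ ; disjoint = disjoint' ; covers = covers' }
      where
        rep' : Fin (suc (size R)) → A
        rep' F.zero    = y
        rep' (F.suc i) = rep R i
        rep'∈ : ∀ i → rep' i ∈ y ∷ V
        rep'∈ F.zero    = here refl
        rep'∈ (F.suc i) = there (rep∈ R i)
        apart : ∀ j {z} → z ∈ cls y → z ∈ cls (rep R j) → ⊥
        apart j p q = new j (merge y∈U (V⊆U (rep∈ R j)) p q (self y∈U))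
        disjoint' : ∀ i j {z} → z ∈ cls (rep' i) → z ∈ cls (rep' j) → i ≡ j
        disjoint' F.zero    F.zero    p q = refl
        disjoint' F.zero    (F.suc j) p q = contradiction q (apart j p)
        disjoint' (F.suc i) F.zero    p q = contradiction p (apart i q)
        disjoint' (F.suc i) (F.suc j) p q = cong F.suc (disjoint R i j p q)
        covers' : ∀ {z} → z ∈ y ∷ V → ∃ λ i → z ∈ cls (rep' i)
        covers' (here refl) = F.zero , self y∈U
        covers' (there z∈)  = let (i , q) = covers R z∈ in F.suc i , q

    representatives-of : (V : List A) → (∀ {x} → x ∈ V → x ∈ U) → Representatives V cls
    representatives-of [] _ = record { size = 0 ; rep = λ () ; rep∈ = λ () ; disjoint = λ () ; covers = λ () }
    representatives-of (y ∷ V) V⊆U with representatives-of V (λ p → V⊆U (there p))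
    ... | R with FinP.any? (λ i → y ∈? cls (rep R i))
    ...   | yes (i , y∈) = absorb R i y∈
    ...   | no ¬old      = adjoin (V⊆U (here refl)) (λ p → V⊆U (there p)) R (λ i y∈ → ¬old (i , y∈))

    representatives : Representatives U cls
    representatives = representatives-of U id

module FreeAction {A X : Set} (_≟_ : DecidableEquality X) (act : A → X → X)
  (K : List A) (K-unique : Unique K)
  {e : A} (e∈K : e ∈ K) (act-e : ∀ x → act e x ≡ x)
  (act-compose : ∀ {a b} → a ∈ K → b ∈ K → ∃ λ c → c ∈ K × (∀ x → act c x ≡ act a (act b x)))
  (act-invert : ∀ {a} → a ∈ K → ∃ λ a' → a' ∈ K × (∀ x → act a' (act a x) ≡ x))
  (U : List X) (U-unique : Unique U)
  (U-closed : ∀ {a x} → a ∈ K → x ∈ U → act a x ∈ U)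
  (free : ∀ {a b x} → a ∈ K → b ∈ K → x ∈ U → act a x ≡ act b x → a ≡ b) where

  open Partition _≟_ using (Representatives; partition-length; representatives)

  InOrbit : X → X → Set
  InOrbit x y = ∃ λ a → a ∈ K × act a x ≡ y

  orbit : X → List X
  orbit x = map (λ a → act a x) K

  ∈-orbit⁻ : ∀ {x y} → y ∈ orbit x → InOrbit x y
  ∈-orbit⁻ y∈ = let (a , a∈ , y≡ax) = ∈-map⁻ _ y∈ in a , a∈ , sym y≡ax

  ∈-orbit⁺ : ∀ {x y} → InOrbit x y → y ∈ orbit x
  ∈-orbit⁺ (a , a∈ , refl) = ∈-map⁺ _ a∈

  orbit-refl : ∀ x → InOrbit x x
  orbit-refl x = e , e∈K , act-e x

  orbit-sym : ∀ {x y} → InOrbit x y → InOrbit y x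
  orbit-sym (a , a∈ , refl) = let (a' , a'∈ , a'a) = act-invert a∈ in a' , a'∈ , a'a _

  orbit-trans : ∀ {x y z} → InOrbit x y → InOrbit y z → InOrbit x z
  orbit-trans (a , a∈ , refl) (b , b∈ , refl) =
    let (c , c∈ , c≡ba) = act-compose b∈ a∈ in c , c∈ , c≡ba _

  orbit-⊆ : ∀ {x y} → x ∈ U → InOrbit x y → y ∈ U
  orbit-⊆ x∈ (a , a∈ , refl) = U-closed a∈ x∈

  orbit-unique : ∀ {x} → x ∈ U → Unique (orbit x)
  orbit-unique x∈ = map-unique _ (λ a∈ b∈ → free a∈ b∈ x∈) K-unique

  record Transversal : Set where
    field
      size     : ℕ
      rep      : Fin size → X
      rep∈     : ∀ i → rep i ∈ U
      distinct : ∀ i j → InOrbit (rep i) (rep j) → i ≡ j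
      covers   : ∀ {x} → x ∈ U → ∃ λ i → InOrbit (rep i) x

  orbit-count : (T : Transversal) → length U ≡ Transversal.size T * length K
  orbit-count T = partition-length R U-unique (λ i → orbit-unique (rep∈ i)) (λ i → length-map _ K)
                    (λ i z∈ → orbit-⊆ (rep∈ i) (∈-orbit⁻ z∈))
    where
      open Transversal T
      R : Representatives U orbit
      R = record
        { size = size ; rep = rep ; rep∈ = rep∈
        ; disjoint = λ i j zi zj → distinct i j (orbit-trans (∈-orbit⁻ zi) (orbit-sym (∈-orbit⁻ zj)))
        ; covers = λ x∈ → let (i , ix) = covers x∈ in i , ∈-orbit⁺ ix }

  transversal : Transversal
  transversal = record
    { size = size ; rep = rep ; rep∈ = rep∈
    ; distinct = λ i j ij → disjoint i j (∈-orbit⁺ ij) (∈-orbit⁺ (orbit-refl (rep j)))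
    ; covers = λ x∈ → let (i , x∈i) = covers x∈ in i , ∈-orbit⁻ x∈i }
    where
      merge : ∀ {x y z w} → x ∈ U → y ∈ U → z ∈ orbit x → z ∈ orbit y → w ∈ orbit x → w ∈ orbit y
      merge _ _ zx zy wx =
        ∈-orbit⁺ (orbit-trans (orbit-trans (∈-orbit⁻ zy) (orbit-sym (∈-orbit⁻ zx))) (∈-orbit⁻ wx))
      open Representatives (representatives (λ {x} _ → ∈-orbit⁺ (orbit-refl x)) merge)

module Perm {n : ℕ} where

  ext : {t u : Map n} → (∀ x → app t x ≡ app u x) → t ≡ u
  ext {t} {u} t≗u = trans (sym (tabulate∘lookup t)) (trans (tabulate-cong t≗u) (tabulate∘lookup u))

  app-∘ : ∀ (g h : Map n) x → app (g ∘ₚ h) x ≡ app g (app h x)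
  app-∘ g h x = lookup∘tabulate _ x

  app-id : ∀ x → app (idPerm {n}) x ≡ x
  app-id x = lookup-allFin x

  ∘-assoc : ∀ (f g h : Map n) → (f ∘ₚ g) ∘ₚ h ≡ f ∘ₚ (g ∘ₚ h)
  ∘-assoc f g h = ext λ x → begin
    app ((f ∘ₚ g) ∘ₚ h) x    ≡⟨ app-∘ (f ∘ₚ g) h x ⟩
    app (f ∘ₚ g) (app h x)   ≡⟨ app-∘ f g (app h x) ⟩
    app f (app g (app h x))  ≡⟨ cong (app f) (sym (app-∘ g h x)) ⟩
    app f (app (g ∘ₚ h) x)   ≡⟨ sym (app-∘ f (g ∘ₚ h) x) ⟩
    app (f ∘ₚ (g ∘ₚ h)) x    ∎

  ∘-identityˡ : ∀ (g : Map n) → idPerm ∘ₚ g ≡ g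
  ∘-identityˡ g = ext λ x → trans (app-∘ idPerm g x) (app-id (app g x))

  ∘-identityʳ : ∀ (g : Map n) → g ∘ₚ idPerm ≡ g
  ∘-identityʳ g = ext λ x → trans (app-∘ g idPerm x) (cong (app g) (app-id x))

  ∘-cancelˡ : ∀ (g : Map n) {a b} → IsPerm g → g ∘ₚ a ≡ g ∘ₚ b → a ≡ b
  ∘-cancelˡ g {a} {b} g-perm ga≡gb =
    ext λ x → g-perm _ _ (trans (sym (app-∘ g a x)) (trans (cong (λ t → app t x) ga≡gb) (app-∘ g b x)))

  ∘-interchange : ∀ a b c h h' → c ∘ₚ h ≡ h' ∘ₚ c → (a ∘ₚ c) ∘ₚ (h ∘ₚ b) ≡ (a ∘ₚ h') ∘ₚ (c ∘ₚ b)
  ∘-interchange a b c h h' ch≡h'c = begin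
    (a ∘ₚ c) ∘ₚ (h ∘ₚ b)   ≡⟨ ∘-assoc a c (h ∘ₚ b) ⟩
    a ∘ₚ (c ∘ₚ (h ∘ₚ b))   ≡⟨ cong (a ∘ₚ_) (sym (∘-assoc c h b)) ⟩
    a ∘ₚ ((c ∘ₚ h) ∘ₚ b)   ≡⟨ cong (λ t → a ∘ₚ (t ∘ₚ b)) ch≡h'c ⟩
    a ∘ₚ ((h' ∘ₚ c) ∘ₚ b)  ≡⟨ cong (a ∘ₚ_) (∘-assoc h' c b) ⟩
    a ∘ₚ (h' ∘ₚ (c ∘ₚ b))  ≡⟨ sym (∘-assoc a h' (c ∘ₚ b)) ⟩
    (a ∘ₚ h') ∘ₚ (c ∘ₚ b)  ∎

  _≟ₘ_ : DecidableEquality (Map n)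
  _≟ₘ_ = ≡-dec FinP._≟_

  pow : Map n → ℕ → Map n
  pow g zero    = idPerm
  pow g (suc j) = g ∘ₚ pow g j

  pow-+ : ∀ g a b → pow g (a + b) ≡ pow g a ∘ₚ pow g b
  pow-+ g zero    b = sym (∘-identityˡ (pow g b))
  pow-+ g (suc a) b = trans (cong (g ∘ₚ_) (pow-+ g a b)) (sym (∘-assoc g (pow g a) (pow g b)))

  pow-* : ∀ g m q → pow g m ≡ idPerm → pow g (q * m) ≡ idPerm
  pow-* g m zero    gᵐ≡1 = refl
  pow-* g m (suc q) gᵐ≡1 = begin
    pow g (m + q * m)         ≡⟨ pow-+ g m (q * m) ⟩
    pow g m ∘ₚ pow g (q * m)  ≡⟨ cong₂ _∘ₚ_ gᵐ≡1 (pow-* g m q gᵐ≡1) ⟩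
    idPerm ∘ₚ idPerm          ≡⟨ ∘-identityˡ idPerm ⟩
    idPerm                    ∎

  pow-preserves : ∀ (P : Fin n → Set) f → (∀ {y} → P y → P (app f y)) → ∀ j {y} → P y → P (app (pow f j) y)
  pow-preserves P f f-pres zero    {y} py = subst P (sym (app-id y)) py
  pow-preserves P f f-pres (suc j) {y} py =
    subst P (sym (app-∘ f (pow f j) y)) (f-pres (pow-preserves P f f-pres j py))

  app-pow-conj : ∀ g g' f → (∀ y → app g' (app g y) ≡ y) → (∀ y → app g (app g' y) ≡ y) →
                 ∀ j y → app (pow (g' ∘ₚ (f ∘ₚ g)) j) y ≡ app g' (app (pow f j) (app g y))
  app-pow-conj g g' f g'g gg' zero y =
    trans (app-id y) (sym (trans (cong (app g') (app-id (app g y))) (g'g y)))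
  app-pow-conj g g' f g'g gg' (suc j) y = begin
    app (f' ∘ₚ pow f' j) y                                ≡⟨ app-∘ f' (pow f' j) y ⟩
    app f' (app (pow f' j) y)                             ≡⟨ cong (app f') (app-pow-conj g g' f g'g gg' j y) ⟩
    app f' (app g' z)                                     ≡⟨ app-∘ g' (f ∘ₚ g) (app g' z) ⟩
    app g' (app (f ∘ₚ g) (app g' z))                      ≡⟨ cong (app g') (app-∘ f g (app g' z)) ⟩
    app g' (app f (app g (app g' z)))                     ≡⟨ cong (λ t → app g' (app f t)) (gg' z) ⟩
    app g' (app f z)                                      ≡⟨ cong (app g') (sym (app-∘ f (pow f j) (app g y))) ⟩
    app g' (app (f ∘ₚ pow f j) (app g y))                 ∎
    where
      f' = g' ∘ₚ (f ∘ₚ g)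
      z  = app (pow f j) (app g y)

  conj-pow-id : ∀ g g' f j → (∀ y → app g' (app g y) ≡ y) → (∀ y → app g (app g' y) ≡ y) →
                pow (g' ∘ₚ (f ∘ₚ g)) j ≡ idPerm → pow f j ≡ idPerm
  conj-pow-id g g' f j g'g gg' f'ʲ≡1 = ext λ z → begin
    app (pow f j) z                                  ≡⟨ sym (gg' (app (pow f j) z)) ⟩
    app g (app g' (app (pow f j) z))                 ≡⟨ cong (λ t → app g (app g' (app (pow f j) t))) (sym (gg' z)) ⟩
    app g (app g' (app (pow f j) (app g (app g' z)))) ≡⟨ cong (app g) (sym (app-pow-conj g g' f g'g gg' j (app g' z))) ⟩
    app g (app (pow (g' ∘ₚ (f ∘ₚ g)) j) (app g' z))  ≡⟨ cong (λ t → app g (app t (app g' z))) f'ʲ≡1 ⟩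
    app g (app idPerm (app g' z))                    ≡⟨ cong (app g) (app-id (app g' z)) ⟩
    app g (app g' z)                                 ≡⟨ gg' z ⟩
    z                                                ≡⟨ sym (app-id z) ⟩
    app idPerm z                                     ∎

  -- g has order suc pred: the least positive exponent with g^e = 1.
  record Order (g : Map n) : Set where
    field
      pred      : ℕ
      pow-order : pow g (suc pred) ≡ idPerm
      minimal   : ∀ j → j < pred → pow g (suc j) ≢ idPerm

    order : ℕ
    order = suc pred

    pow≡id⇒≡0 : ∀ r → r < order → pow g r ≡ idPerm → r ≡ 0
    pow≡id⇒≡0 zero    _         _ = refl
    pow≡id⇒≡0 (suc j) (s≤s j<m) e = contradiction e (minimal j j<m)

    pow-mod : ∀ a → pow g a ≡ pow g (a % order)
    pow-mod a = begin
      pow g a                                               ≡⟨ cong (pow g) (m≡m%n+[m/n]*n a order) ⟩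
      pow g (a % order + (a / order) * order)               ≡⟨ pow-+ g (a % order) _ ⟩
      pow g (a % order) ∘ₚ pow g ((a / order) * order)      ≡⟨ cong (pow g (a % order) ∘ₚ_) (pow-* g order (a / order) pow-order) ⟩
      pow g (a % order) ∘ₚ idPerm                           ≡⟨ ∘-identityʳ _ ⟩
      pow g (a % order)                                     ∎

    order-∣ : ∀ a → pow g a ≡ idPerm → order ∣ a
    order-∣ a gᵃ≡1 = m%n≡0⇒n∣m a order (pow≡id⇒≡0 (a % order) (m%n<n a order) (trans (sym (pow-mod a)) gᵃ≡1))

    inverse : Map n
    inverse = pow g pred

    ∘-inverse : g ∘ₚ inverse ≡ idPerm
    ∘-inverse = pow-order

    inverse-∘ : inverse ∘ₚ g ≡ idPerm
    inverse-∘ = begin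
      inverse ∘ₚ g           ≡⟨ cong (inverse ∘ₚ_) (sym (∘-identityʳ g)) ⟩
      pow g pred ∘ₚ pow g 1  ≡⟨ sym (pow-+ g pred 1) ⟩
      pow g (pred + 1)       ≡⟨ cong (pow g) (+-comm pred 1) ⟩
      pow g (suc pred)       ≡⟨ pow-order ⟩
      idPerm                 ∎

    app-inverse : ∀ y → app inverse (app g y) ≡ y
    app-inverse y = trans (sym (app-∘ inverse g y)) (trans (cong (λ t → app t y) inverse-∘) (app-id y))

    app-∘-inverse : ∀ y → app g (app inverse y) ≡ y
    app-∘-inverse y = trans (sym (app-∘ g inverse y)) (trans (cong (λ t → app t y) ∘-inverse) (app-id y))

    right-inverse-unique : ∀ {h} → g ∘ₚ h ≡ idPerm → h ≡ inverse
    right-inverse-unique {h} gh≡1 = begin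
      h                      ≡⟨ sym (∘-identityˡ h) ⟩
      idPerm ∘ₚ h            ≡⟨ cong (_∘ₚ h) (sym inverse-∘) ⟩
      (inverse ∘ₚ g) ∘ₚ h    ≡⟨ ∘-assoc inverse g h ⟩
      inverse ∘ₚ (g ∘ₚ h)    ≡⟨ cong (inverse ∘ₚ_) gh≡1 ⟩
      inverse ∘ₚ idPerm      ≡⟨ ∘-identityʳ inverse ⟩
      inverse                ∎

    inverse-cancel : ∀ {h} → inverse ∘ₚ h ≡ idPerm → h ≡ g
    inverse-cancel {h} g⁻¹h≡1 = begin
      h                      ≡⟨ sym (∘-identityˡ h) ⟩
      idPerm ∘ₚ h            ≡⟨ cong (_∘ₚ h) (sym ∘-inverse) ⟩
      (g ∘ₚ inverse) ∘ₚ h    ≡⟨ ∘-assoc g inverse h ⟩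
      g ∘ₚ (inverse ∘ₚ h)    ≡⟨ cong (g ∘ₚ_) g⁻¹h≡1 ⟩
      g ∘ₚ idPerm            ≡⟨ ∘-identityʳ g ⟩
      g                      ∎

  module PermGroup {H : List (Map n)} (PH : IsPermGroup H) where
    open IsPermGroup PH

    pow∈ : ∀ {g} → g ∈ H → ∀ j → pow g j ∈ H
    pow∈ g∈ zero    = hasId
    pow∈ g∈ (suc j) = closed g∈ (pow∈ g∈ j)

    period : ∀ {g} → g ∈ H → ∀ {a b} → a < b → pow g a ≡ pow g b → pow g (b ∸ a) ≡ idPerm
    period {g} g∈ {a} {b} a<b gᵃ≡gᵇ = ∘-cancelˡ (pow g a) (perms (pow∈ g∈ a)) (begin
      pow g a ∘ₚ pow g (b ∸ a)  ≡⟨ sym (pow-+ g a (b ∸ a)) ⟩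
      pow g (a + (b ∸ a))       ≡⟨ cong (pow g) (m+[n∸m]≡n (<⇒≤ a<b)) ⟩
      pow g b                   ≡⟨ sym gᵃ≡gᵇ ⟩
      pow g a                   ≡⟨ sym (∘-identityʳ (pow g a)) ⟩
      pow g a ∘ₚ idPerm         ∎)

    -- Pigeonhole: among g^0, …, g^|H| two coincide, so some positive power is 1.
    some-period : ∀ {g} → g ∈ H → ∃ λ d → pow g (suc d) ≡ idPerm
    some-period {g} g∈ with FinP.pigeonhole (n<1+n (length H)) (λ i → Any.index (pow∈ g∈ (toℕ i)))
    ... | i , j , i<j , same-index = toℕ j ∸ toℕ i ∸ 1 , trans (cong (pow g) 1+d≡j-i) (period g∈ i<j gⁱ≡gʲ)
      where
        gⁱ≡gʲ : pow g (toℕ i) ≡ pow g (toℕ j)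
        gⁱ≡gʲ = trans (lookup-index (pow∈ g∈ (toℕ i)))
                  (trans (cong (L.lookup H) same-index) (sym (lookup-index (pow∈ g∈ (toℕ j)))))
        1+d≡j-i : suc (toℕ j ∸ toℕ i ∸ 1) ≡ toℕ j ∸ toℕ i
        1+d≡j-i = trans (sym (+-∸-assoc 1 (m<n⇒0<n∸m i<j))) (m+n∸m≡n 1 (toℕ j ∸ toℕ i))

    abstract
      order-of : ∀ {g} → g ∈ H → Order g
      order-of {g} g∈ with some-period g∈
      ... | d , gᵈ⁺¹≡1 with least (λ j → pow g (suc j) ≡ idPerm) (λ j → pow g (suc j) ≟ₘ idPerm) d gᵈ⁺¹≡1
      ...   | m , gᵐ⁺¹≡1 , below = record { pred = m ; pow-order = gᵐ⁺¹≡1 ; minimal = below }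

    inv : ∀ {g} → g ∈ H → Map n
    inv g∈ = Order.inverse (order-of g∈)

    inv∈ : ∀ {g} (g∈ : g ∈ H) → inv g∈ ∈ H
    inv∈ g∈ = pow∈ g∈ (Order.pred (order-of g∈))

    powers : ∀ {g} → g ∈ H → List (Map n)
    powers {g} g∈ = applyUpTo (pow g) (Order.order (order-of g∈))

    length-powers : ∀ {g} (g∈ : g ∈ H) → length (powers g∈) ≡ Order.order (order-of g∈)
    length-powers {g} g∈ = length-applyUpTo (pow g) _

    cyclic-subgroup : ∀ {g} (g∈ : g ∈ H) → IsSubgroup (powers g∈) H
    cyclic-subgroup {g} g∈ = record { perms = λ a∈ → perms (⊆H a∈) ; unique = distinct
                                    ; hasId = ∈-powers 0 ; closed = powers-closed } , ⊆H
      where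
        open Order (order-of g∈)
        ∈-powers : ∀ j → pow g j ∈ powers g∈
        ∈-powers j = subst (_∈ powers g∈) (sym (pow-mod j)) (∈-applyUpTo⁺ (pow g) (m%n<n j order))
        ⊆H : ∀ {a} → a ∈ powers g∈ → a ∈ H
        ⊆H a∈ = let (j , _ , a≡gʲ) = ∈-applyUpTo⁻ (pow g) a∈ in subst (_∈ H) (sym a≡gʲ) (pow∈ g∈ j)
        distinct : Unique (powers g∈)
        distinct = Unique.applyUpTo⁺₁ (pow g) order λ {i} {j} i<j j<ord gⁱ≡gʲ →
          <⇒≢ (m<n⇒0<n∸m i<j) (sym (pow≡id⇒≡0 (j ∸ i) (≤-<-trans (m∸n≤m j i) j<ord) (period g∈ i<j gⁱ≡gʲ)))
        powers-closed : ∀ {a b} → a ∈ powers g∈ → b ∈ powers g∈ → (a ∘ₚ b) ∈ powers g∈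
        powers-closed a∈ b∈ with ∈-applyUpTo⁻ (pow g) a∈ | ∈-applyUpTo⁻ (pow g) b∈
        ... | i , _ , refl | j , _ , refl = subst (_∈ powers g∈) (pow-+ g i j) (∈-powers (i + j))

  -- Lagrange: the order of a subgroup divides the order of the group.  K acts
  -- freely on H by right multiplication; the orbits are the cosets gK.
  lagrange : ∀ {H K : List (Map n)} → IsPermGroup H → IsSubgroup K H → ∣ K ∣ᴳ ∣ ∣ H ∣ᴳ
  lagrange {H} {K} PH (PK , K⊆H) = divides (Transversal.size cosets) (orbit-count cosets)
    where
      open IsPermGroup
      open PermGroup PK using (order-of; inv; inv∈)
      compose : ∀ {a b} → a ∈ K → b ∈ K → ∃ λ c → c ∈ K × (∀ g → g ∘ₚ c ≡ (g ∘ₚ b) ∘ₚ a)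
      compose {a} {b} a∈ b∈ = b ∘ₚ a , closed PK b∈ a∈ , λ g → sym (∘-assoc g b a)
      invert : ∀ {a} → a ∈ K → ∃ λ a' → a' ∈ K × (∀ g → (g ∘ₚ a) ∘ₚ a' ≡ g)
      invert {a} a∈ = inv a∈ , inv∈ a∈ , λ g → begin
        (g ∘ₚ a) ∘ₚ inv a∈   ≡⟨ ∘-assoc g a (inv a∈) ⟩
        g ∘ₚ (a ∘ₚ inv a∈)   ≡⟨ cong (g ∘ₚ_) (Order.∘-inverse (order-of a∈)) ⟩
        g ∘ₚ idPerm          ≡⟨ ∘-identityʳ g ⟩
        g                    ∎
      open FreeAction _≟ₘ_ (λ a g → g ∘ₚ a) K (unique PK) (hasId PK) ∘-identityʳ compose invert
             H (unique PH) (λ a∈ g∈ → closed PH g∈ (K⊆H a∈)) (λ {_} {_} {g} _ _ g∈ → ∘-cancelˡ g (perms PH g∈))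
      cosets : Transversal
      cosets = transversal

  pow-order-id : ∀ {H} → IsPermGroup H → ∀ {g} → g ∈ H → pow g ∣ H ∣ᴳ ≡ idPerm
  pow-order-id {H} PH {g} g∈ = begin
    pow g ∣ H ∣ᴳ          ≡⟨ cong (pow g) (trans |H|≡q*|⟨g⟩| (cong (q *_) (length-powers g∈))) ⟩
    pow g (q * order)     ≡⟨ pow-* g order q pow-order ⟩
    idPerm                ∎
    where
      open PermGroup PH using (cyclic-subgroup; length-powers; order-of)
      open Order (order-of g∈)
      open _∣_ (lagrange PH (cyclic-subgroup g∈)) renaming (quotient to q; equality to |H|≡q*|⟨g⟩|)

  coprime-exponents : ∀ {H} → IsPermGroup H → ∀ {g a b} → g ∈ H →
                      pow g a ≡ idPerm → pow g b ≡ idPerm → Coprime a b → g ≡ idPerm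
  coprime-exponents PH {g} {a} {b} g∈ gᵃ≡1 gᵇ≡1 a⊥b = begin
    g                 ≡⟨ sym (∘-identityʳ g) ⟩
    pow g 1           ≡⟨ cong (λ m → pow g (suc m)) pred≡0 ⟩
    pow g (suc pred)  ≡⟨ pow-order ⟩
    idPerm            ∎
    where
      open Order (PermGroup.order-of PH g∈)
      pred≡0 : 0 ≡ pred
      pred≡0 = sym (suc-injective (a⊥b (order-∣ a gᵃ≡1 , order-∣ b gᵇ≡1)))

  semiregular⇒free : ∀ {H} → IsPermGroup H → IsSemiregular H →
                     ∀ x {p q} → p ∈ H → q ∈ H → app p x ≡ app q x → p ≡ q
  semiregular⇒free PH semi x {p} {q} p∈ q∈ px≡qx = inverse-cancel (semi (closed (inv∈ q∈) p∈) x q⁻¹p-fixes)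
    where
      open IsPermGroup PH using (closed)
      open PermGroup PH using (order-of; inv∈)
      open Order (order-of q∈)
      q⁻¹p-fixes : app (inverse ∘ₚ p) x ≡ x
      q⁻¹p-fixes = trans (app-∘ inverse p x) (trans (cong (app inverse) px≡qx) (app-inverse x))

  semiregular-⊆ : ∀ {H K : List (Map n)} → IsSemiregular H → K ⊆ᴳ H → IsSemiregular K
  semiregular-⊆ semi K⊆H a∈ = semi (K⊆H a∈)

  module SemiregularAction {K : List (Map n)} (PK : IsPermGroup K) (semi : IsSemiregular K)
    (U : List (Fin n)) (U-unique : Unique U) (U-closed : ∀ {a x} → a ∈ K → x ∈ U → app a x ∈ U) =
    FreeAction FinP._≟_ app K (IsPermGroup.unique PK) (IsPermGroup.hasId PK) app-id
      (λ {a} {b} a∈ b∈ → a ∘ₚ b , IsPermGroup.closed PK a∈ b∈ , app-∘ a b)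
      (λ a∈ → PermGroup.inv PK a∈ , PermGroup.inv∈ PK a∈ , Order.app-inverse (PermGroup.order-of PK a∈))
      U U-unique U-closed (λ a∈ b∈ _ → semiregular⇒free PK semi _ a∈ b∈)

  module SemiregularOnPoints {K : List (Map n)} (PK : IsPermGroup K) (semi : IsSemiregular K) =
    SemiregularAction PK semi (allFin n) (Unique.allFin⁺ n) (λ _ _ → ∈-allFin _)

  stabiliser-group : ∀ {G} → IsPermGroup G → ∀ v → IsPermGroup (Stab G v)
  stabiliser-group {G} PG v = record
    { perms = λ g∈ → perms (proj₁ (∈-Stab⁻ g∈))
    ; unique = Unique.filter⁺ (λ g → app g v FinP.≟ v) unique
    ; hasId = ∈-Stab⁺ hasId (app-id v)
    ; closed = λ {g} {h} g∈ h∈ →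
        let (g∈G , gv) = ∈-Stab⁻ g∈ ; (h∈G , hv) = ∈-Stab⁻ h∈
        in ∈-Stab⁺ (closed g∈G h∈G) (trans (app-∘ g h v) (trans (cong (app g) hv) gv)) }
    where
      open IsPermGroup PG
      ∈-Stab⁻ : ∀ {g} → g ∈ Stab G v → g ∈ G × app g v ≡ v
      ∈-Stab⁻ = ∈-filter⁻ (λ g → app g v FinP.≟ v)
      ∈-Stab⁺ : ∀ {g} → g ∈ G → app g v ≡ v → g ∈ Stab G v
      ∈-Stab⁺ = ∈-filter⁺ (λ g → app g v FinP.≟ v)

  module Product {G N C : List (Map n)} (PG : IsPermGroup G) (N⊴G : IsNormal N G) (C≤G : IsSubgroup C G) where
    private
      PN = proj₁ (proj₁ N⊴G)
      PC = proj₁ C≤G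
      module N = IsPermGroup PN
      module C = IsPermGroup PC
    open IsPermGroup PG using (closed)

    NC : List (Map n)
    NC = deduplicate _≟ₘ_ (cartesianProductWith _∘ₚ_ N C)

    ∈NC⁻ : ∀ {p} → p ∈ NC → ∃₂ λ h c → h ∈ N × c ∈ C × p ≡ h ∘ₚ c
    ∈NC⁻ p∈ = ∈-cartesianProductWith⁻ _∘ₚ_ N C (∈-deduplicate⁻ _≟ₘ_ (cartesianProductWith _∘ₚ_ N C) p∈)

    ∈NC⁺ : ∀ {h c} → h ∈ N → c ∈ C → (h ∘ₚ c) ∈ NC
    ∈NC⁺ h∈ c∈ = ∈-deduplicate⁺ _≟ₘ_ (∈-cartesianProductWith⁺ _∘ₚ_ h∈ c∈)

    C⊆NC : C ⊆ᴳ NC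
    C⊆NC {c} c∈ = subst (_∈ NC) (∘-identityˡ c) (∈NC⁺ N.hasId c∈)

    -- NC is closed: (h₁c₁)(h₂c₂) = (h₁h₃)(c₁c₂) where c₁h₂ = h₃c₁.
    NC-closed : ∀ {p q} → p ∈ NC → q ∈ NC → (p ∘ₚ q) ∈ NC
    NC-closed p∈ q∈ with ∈NC⁻ p∈ | ∈NC⁻ q∈
    ... | h₁ , c₁ , h₁∈ , c₁∈ , refl | h₂ , c₂ , h₂∈ , c₂∈ , refl with proj₂ N⊴G (proj₂ C≤G c₁∈) h₂∈
    ...   | h₃ , h₃∈ , c₁h₂≡h₃c₁ =
      subst (_∈ NC) (sym (∘-interchange h₁ c₂ c₁ h₂ h₃ c₁h₂≡h₃c₁)) (∈NC⁺ (N.closed h₁∈ h₃∈) (C.closed c₁∈ c₂∈))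

    NC≤G : IsSubgroup NC G
    NC≤G = record { perms = λ p∈ → IsPermGroup.perms PG (NC⊆G p∈)
                  ; unique = deduplicate-! _≟ₘ_ (cartesianProductWith _∘ₚ_ N C)
                  ; hasId = C⊆NC C.hasId ; closed = NC-closed } , NC⊆G
      where
        NC⊆G : NC ⊆ᴳ G
        NC⊆G p∈ with ∈NC⁻ p∈
        ... | h , c , h∈ , c∈ , refl = closed (proj₂ (proj₁ N⊴G) h∈) (proj₂ C≤G c∈)

    C≤NC : IsSubgroup C NC
    C≤NC = PC , C⊆NC

    pow-coset : ∀ {h c} → h ∈ N → c ∈ C → ∀ j → ∃ λ h' → h' ∈ N × pow (h ∘ₚ c) j ≡ h' ∘ₚ pow c j
    pow-coset h∈ c∈ zero = idPerm , N.hasId , sym (∘-identityˡ idPerm)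
    pow-coset {h} {c} h∈ c∈ (suc j) with pow-coset h∈ c∈ j
    ... | h₁ , h₁∈ , dʲ≡h₁cʲ with proj₂ N⊴G (proj₂ C≤G c∈) h₁∈
    ...   | h₂ , h₂∈ , ch₁≡h₂c = h ∘ₚ h₂ , N.closed h∈ h₂∈ , (begin
      (h ∘ₚ c) ∘ₚ pow (h ∘ₚ c) j   ≡⟨ cong ((h ∘ₚ c) ∘ₚ_) dʲ≡h₁cʲ ⟩
      (h ∘ₚ c) ∘ₚ (h₁ ∘ₚ pow c j)  ≡⟨ ∘-interchange h (pow c j) c h₁ h₂ ch₁≡h₂c ⟩
      (h ∘ₚ h₂) ∘ₚ pow c (suc j)   ∎)

open Perm

module Lemma4p5 {n : ℕ} {G N C : List (Map n)} (v : Fin n)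
  (PG : IsPermGroup G) (transitive : IsTransitive G) (N⊴G : IsNormal N G)
  (C≤G : IsSubgroup C G) (C-semiregular : IsSemiregular C)
  (coprime : Coprime ∣ N ∣ᴳ ∣ Stab G v ∣ᴳ) where

  private
    PN = proj₁ (proj₁ N⊴G)
    N⊆G = proj₂ (proj₁ N⊴G)
    PC = proj₁ C≤G
    C⊆G = proj₂ C≤G
    module G = IsPermGroup PG
    module N = IsPermGroup PN
  open Product PG N⊴G C≤G

  -- An element fixing a point x is conjugate, by some g with g v = x, into
  -- G_v; hence it is killed by |G_v|.
  fixer-exponent : ∀ {f x} → f ∈ G → app f x ≡ x → pow f ∣ Stab G v ∣ᴳ ≡ idPerm
  fixer-exponent {f} {x} f∈ fx≡x with transitive v x
  ... | g , g∈ , gv≡x =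
    conj-pow-id g g⁻¹ f ∣ Stab G v ∣ᴳ app-inverse app-∘-inverse (pow-order-id (stabiliser-group PG v) f'∈Gv)
    where
      open Order (PermGroup.order-of PG g∈) using (app-inverse; app-∘-inverse) renaming (inverse to g⁻¹)
      f'v≡v : app (g⁻¹ ∘ₚ (f ∘ₚ g)) v ≡ v
      f'v≡v = begin
        app (g⁻¹ ∘ₚ (f ∘ₚ g)) v     ≡⟨ app-∘ g⁻¹ (f ∘ₚ g) v ⟩
        app g⁻¹ (app (f ∘ₚ g) v)    ≡⟨ cong (app g⁻¹) (app-∘ f g v) ⟩
        app g⁻¹ (app f (app g v))   ≡⟨ cong (λ y → app g⁻¹ (app f y)) gv≡x ⟩
        app g⁻¹ (app f x)           ≡⟨ cong (app g⁻¹) (trans fx≡x (sym gv≡x)) ⟩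
        app g⁻¹ (app g v)           ≡⟨ app-inverse v ⟩
        v                           ∎
      f'∈Gv : g⁻¹ ∘ₚ (f ∘ₚ g) ∈ Stab G v
      f'∈Gv = ∈-filter⁺ (λ g → app g v FinP.≟ v) (G.closed (PermGroup.inv∈ PG g∈) (G.closed f∈ g∈)) f'v≡v

  fixer-trivial : ∀ {d x} → d ∈ G → app d x ≡ x → pow d ∣ N ∣ᴳ ≡ idPerm → d ≡ idPerm
  fixer-trivial d∈ dx≡x dᴺ≡1 = coprime-exponents PG d∈ dᴺ≡1 (fixer-exponent d∈ dx≡x) coprime

  N-semiregular : IsSemiregular N
  N-semiregular h∈ x hx≡x = fixer-trivial (N⊆G h∈) hx≡x (pow-order-id PN h∈)

  module _ {c h x} (c∈ : c ∈ C) (h∈ : h ∈ N) (hcx≡x : app h (app c x) ≡ x) where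
    private
      open PermGroup PC using (order-of; powers; cyclic-subgroup; length-powers)
      open Order (order-of c∈) using (order; pow-order)

      -- The N-orbit of x; it has |N| points since N is semiregular.
      Nx : List (Fin n)
      Nx = map (λ h → app h x) N

      Nx-unique : Unique Nx
      Nx-unique = map-unique _ (λ a∈ b∈ → semiregular⇒free PN N-semiregular x a∈ b∈) N.unique

      -- c maps Nx into itself: c h₁ x = h₂ c x = h₂ h⁻¹ x, where c h₁ = h₂ c.
      c-preserves-Nx : ∀ {y} → y ∈ Nx → app c y ∈ Nx
      c-preserves-Nx y∈ with ∈-map⁻ _ y∈
      ... | h₁ , h₁∈ , refl with proj₂ N⊴G (C⊆G c∈) h₁∈
      ...   | h₂ , h₂∈ , ch₁≡h₂c = subst (_∈ Nx) h₂h⁻¹x≡ch₁x (∈-map⁺ _ (N.closed h₂∈ (PermGroup.inv∈ PN h∈)))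
        where
          open Order (PermGroup.order-of PN h∈) using () renaming (inverse to h⁻¹; app-inverse to h⁻¹h)
          h₂h⁻¹x≡ch₁x : app (h₂ ∘ₚ h⁻¹) x ≡ app c (app h₁ x)
          h₂h⁻¹x≡ch₁x = begin
            app (h₂ ∘ₚ h⁻¹) x                    ≡⟨ app-∘ h₂ h⁻¹ x ⟩
            app h₂ (app h⁻¹ x)                   ≡⟨ cong (λ y → app h₂ (app h⁻¹ y)) (sym hcx≡x) ⟩
            app h₂ (app h⁻¹ (app h (app c x)))   ≡⟨ cong (app h₂) (h⁻¹h (app c x)) ⟩
            app h₂ (app c x)                     ≡⟨ sym (app-∘ h₂ c x) ⟩
            app (h₂ ∘ₚ c) x                      ≡⟨ cong (λ t → app t x) (sym ch₁≡h₂c) ⟩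
            app (c ∘ₚ h₁) x                      ≡⟨ app-∘ c h₁ x ⟩
            app c (app h₁ x)                     ∎

      -- ⟨c⟩ ≤ C acts freely on Nx, so ord(c) divides |Nx| = |N|.
      order-∣-∣N∣ : order ∣ ∣ N ∣ᴳ
      order-∣-∣N∣ = divides (Transversal.size transversal) (begin
        ∣ N ∣ᴳ                                        ≡⟨ sym (length-map _ N) ⟩
        length Nx                                     ≡⟨ orbit-count transversal ⟩
        Transversal.size transversal * length (powers c∈) ≡⟨ cong (Transversal.size transversal *_) (length-powers c∈) ⟩
        Transversal.size transversal * order          ∎)
        where
          ⟨c⟩-closed : ∀ {a y} → a ∈ powers c∈ → y ∈ Nx → app a y ∈ Nx
          ⟨c⟩-closed a∈ y∈ with ∈-applyUpTo⁻ (pow c) a∈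
          ... | j , _ , refl = pow-preserves (_∈ Nx) c c-preserves-Nx j y∈
          open SemiregularAction (proj₁ (cyclic-subgroup c∈)) (semiregular-⊆ C-semiregular (proj₂ (cyclic-subgroup c∈)))
                 Nx Nx-unique ⟨c⟩-closed

      hc-fixes-x : app (h ∘ₚ c) x ≡ x
      hc-fixes-x = trans (app-∘ h c x) hcx≡x

      -- (hc)^ord(c) = h' c^ord(c) = h' with h' ∈ N fixing x, so it is trivial.
      hc-pow-order : pow (h ∘ₚ c) order ≡ idPerm
      hc-pow-order with pow-coset h∈ c∈ order
      ... | h' , h'∈ , hcᵒ≡h'cᵒ = trans hcᵒ≡h' (N-semiregular h'∈ x h'x≡x)
        where
          hcᵒ≡h' : pow (h ∘ₚ c) order ≡ h'
          hcᵒ≡h' = trans hcᵒ≡h'cᵒ (trans (cong (h' ∘ₚ_) pow-order) (∘-identityʳ h'))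
          h'x≡x : app h' x ≡ x
          h'x≡x = subst (λ t → app t x ≡ x) hcᵒ≡h'
                    (pow-preserves (_≡ x) (h ∘ₚ c) (λ y≡x → trans (cong (app (h ∘ₚ c)) y≡x) hc-fixes-x) order refl)

      -- hc fixes x and is killed by |N|, so hc = 1.
      hc≡1 : h ∘ₚ c ≡ idPerm
      hc≡1 = fixer-trivial (G.closed (N⊆G h∈) (C⊆G c∈)) hc-fixes-x (begin
        pow (h ∘ₚ c) ∣ N ∣ᴳ             ≡⟨ cong (pow (h ∘ₚ c)) (_∣_.equality order-∣-∣N∣) ⟩
        pow (h ∘ₚ c) (q * order)        ≡⟨ pow-* (h ∘ₚ c) order q hc-pow-order ⟩
        idPerm                          ∎)
        where q = _∣_.quotient order-∣-∣N∣

    c∈N : c ∈ N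
    c∈N = subst (_∈ N) (sym (Order.right-inverse-unique (PermGroup.order-of PN h∈) hc≡1)) (PermGroup.inv∈ PN h∈)

  induced-semiregular : InducedSemiregular C N
  induced-semiregular c∈ x (h , h∈ , hcx≡x) = c∈N c∈ h∈ hcx≡x

  -- Hence NC is semiregular: if hc fixes x then c ∈ N, so hc ∈ N fixes x.
  NC-semiregular : IsSemiregular NC
  NC-semiregular p∈ x px≡x with ∈NC⁻ p∈
  ... | h , c , h∈ , c∈ , refl = N-semiregular (N.closed h∈ (c∈N c∈ h∈ hcx≡x)) x px≡x
    where
      hcx≡x : app h (app c x) ≡ x
      hcx≡x = trans (sym (app-∘ h c x)) px≡x

  induced⇒NC : ∀ {x y} → SameInducedOrbit C N x y → SameOrbit NC x y
  induced⇒NC {x} (c , c∈ , h , h∈ , hcx≡y) = h ∘ₚ c , ∈NC⁺ h∈ c∈ , trans (app-∘ h c x) hcx≡y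

  NC⇒induced : ∀ {x y} → SameOrbit NC x y → SameInducedOrbit C N x y
  NC⇒induced {x} (p , p∈ , px≡y) with ∈NC⁻ p∈
  ... | h , c , h∈ , c∈ , refl = c , c∈ , h , h∈ , trans (sym (app-∘ h c x)) px≡y

  -- Counting points by orbits, n = k·|C| = k'·|NC|; with |NC| = q·|C| (Lagrange)
  -- this gives k = q·k'.
  induced-orbits : ∀ {k} → HasOrbits C k → ∃ λ k' → InducedHasOrbits C N k' × k' ∣ k
  induced-orbits {k} (reps , C-distinct , C-covers) = k' , induced-transversal , divides q k≡q*k'
    where
      module OC = SemiregularOnPoints PC C-semiregular
      module ONC = SemiregularOnPoints (proj₁ NC≤G) NC-semiregular
      open ONC.Transversal ONC.transversal renaming (size to k')
      open _∣_ (lagrange (proj₁ NC≤G) C≤NC) renaming (quotient to q; equality to |NC|≡q*|C|)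

      C-orbits : OC.Transversal
      C-orbits = record { size = k ; rep = lookup reps ; rep∈ = λ _ → ∈-allFin _
                        ; distinct = C-distinct ; covers = λ {x} _ → C-covers x }

      induced-transversal : InducedHasOrbits C N k'
      induced-transversal = tabulate rep , distinct' , covers'
        where
          distinct' : ∀ i j → SameInducedOrbit C N (lookup (tabulate rep) i) (lookup (tabulate rep) j) → i ≡ j
          distinct' i j ij = distinct i j
            (induced⇒NC (subst₂ (SameInducedOrbit C N) (lookup∘tabulate rep i) (lookup∘tabulate rep j) ij))
          covers' : ∀ x → ∃ λ i → SameInducedOrbit C N (lookup (tabulate rep) i) x
          covers' x = let (i , ix) = covers (∈-allFin x) in
            i , subst (λ y → SameInducedOrbit C N y x) (sym (lookup∘tabulate rep i)) (NC⇒induced ix)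

      k≡q*k' : k ≡ q * k'
      k≡q*k' = *-cancelʳ-≡ k (q * k') (length C) {{∈⇒length-nonZero (IsPermGroup.hasId PC)}} (begin
        k * length C            ≡⟨ sym (OC.orbit-count C-orbits) ⟩
        length (allFin n)       ≡⟨ ONC.orbit-count ONC.transversal ⟩
        k' * length NC          ≡⟨ cong (k' *_) |NC|≡q*|C| ⟩
        k' * (q * length C)     ≡⟨ sym (*-assoc k' q (length C)) ⟩
        (k' * q) * length C     ≡⟨ cong (_* length C) (*-comm k' q) ⟩
        (q * k') * length C     ∎)

lemma4p5 : (n : ℕ) (G N C : List (Map n)) (v : Fin n) (k : ℕ) →
    IsPermGroup G → IsTransitive G →
    IsNormal N G →
    IsSubgroup C G → IsSemiregular C → HasOrbits C k →
    Coprime ∣ N ∣ᴳ ∣ Stab G v ∣ᴳ →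
    InducedSemiregular C N ×
      (∃ λ k' → InducedHasOrbits C N k' × k' ∣ k)
lemma4p5 n G N C v k PG transitive N⊴G C≤G C-semiregular C-orbits coprime =
  induced-semiregular , induced-orbits C-orbits
  where open Lemma4p5 v PG transitive N⊴G C≤G C-semiregular coprime
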